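{- Let $p$ be an odd prime, $n$ a positive integer, $\epsilon\in\{0,1\}$ and $\Delta_{n,\epsilon}(x)=x^n-(-1)^\epsilon\in\mathbb{Z}_p[x]$. Let $g(x),h(x)\in\mathbb{Z}_p[x]$ be nonconstant polynomials with $g(x)h(x)=\Delta_{n,\epsilon}(x)$. If $g(x)$ is a polynomial in $x^k$ for a positive integer $k$, then $k$ divides $n$ and $h(x)$ is also a polynomial in $x^k$. In particular, if $d=\mathrm{Exp}(g(x))$, then $\mathrm{Exp}(h(x))=d$ and $g_d(x)h_d(x)=\Delta_{n/d,\epsilon}(x)$.
   Context: A polynomial $f(x)$ is a polynomial in $x^k$ if $f(x)=F(x^k)$ for some $F\in\mathbb{Z}_p[x]$. For a nonconstant $f$, $\mathrm{Exp}(f(x))$ is the largest positive integer $k$ such that $f(x)$ is a polynomial in $x^k$, and for $d=\mathrm{Exp}(f(x))$ the associated polynomial $f_d(x)$ is the unique polynomial with $f(x)=f_d(x^d)$. -}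

module Defs where

open import Data.Nat using (ℕ; zero; suc; _≤_)
open import Data.Integer as ℤ using (ℤ; +_; -_; _-_)
open import Data.Integer.Divisibility as ℤD using ()
open import Data.Fin using (Fin)
import Data.Fin as Fin
open import Data.List using (List; []; _∷_; replicate; _++_; map)
open import Data.Product using (Σ; _×_; ∃)
open import Relation.Nullary using (¬_)

-- Polynomials over Z_p are represented by their (finite) coefficient lists
-- over ℤ, lowest degree first; all comparisons are made modulo p.
Poly : Set
Poly = List ℤ

coeff : Poly → ℕ → ℤ
coeff []      _       = + 0
coeff (a ∷ f) zero    = a
coeff (a ∷ f) (suc i) = coeff f i

_+ₚ_ : Poly → Poly → Poly
[]      +ₚ g       = g
(a ∷ f) +ₚ []      = a ∷ f
(a ∷ f) +ₚ (b ∷ g) = (a ℤ.+ b) ∷ (f +ₚ g)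

_*ₚ_ : Poly → Poly → Poly
[]      *ₚ g = []
(a ∷ f) *ₚ g = map (a ℤ.*_) g +ₚ (+ 0 ∷ (f *ₚ g))

_≡_[mod_] : ℤ → ℤ → ℕ → Set
a ≡ b [mod p ] = (+ p) ℤD.∣ (a - b)

_≈[_]_ : Poly → ℕ → Poly → Set
f ≈[ p ] g = ∀ i → coeff f i ≡ coeff g i [mod p ]

Nonconstant : ℕ → Poly → Set
Nonconstant p f = Σ ℕ λ i → (1 ≤ i) × ¬ (coeff f i ≡ + 0 [mod p ])

-- F(x^k) for k ≥ 1: insert k-1 zeros after every coefficient
subst-xk : ℕ → Poly → Poly
subst-xk k []      = []
subst-xk k (a ∷ F) = a ∷ (replicate (k Data.Nat.∸ 1) (+ 0) ++ subst-xk k F)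

PolyIn : ℕ → Poly → ℕ → Set
PolyIn p f k = Σ Poly λ F → f ≈[ p ] subst-xk k F

IsExp : ℕ → Poly → ℕ → Set
IsExp p f d = (1 ≤ d) × PolyIn p f d × (∀ k → 1 ≤ k → PolyIn p f k → k ≤ d)

sgn : Fin 2 → ℤ
sgn Fin.zero       = + 1
sgn (Fin.suc _)    = - (+ 1)

xPow : ℕ → Poly
xPow n = replicate n (+ 0) ++ (+ 1 ∷ [])

Δ : ℕ → Fin 2 → Poly
Δ n ε = xPow n +ₚ (- sgn ε ∷ [])

-- Let a be the top degree of g (mod p); a is a multiple of k. For a residue
-- class r mod k meeting the support of h, let j be the largest index ≡ r with
-- h_j ≢ 0. In the coefficient of x^(a+j) in gh the only surviving term is
-- g_a h_j, so a + j = n. For r = 0 (h_0 ≢ 0 because g_0 h_0 = ∓1) this gives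
-- k ∣ n, and then every such j, hence the whole support of h, lies in kℕ.
-- The claims about Exp follow by exchanging g and h, and G H = Δ_{n/d} by
-- comparing the coefficients of x^(td) on both sides of gh = Δ_{n,ε}.
module Submission where

open import Defs
open import Data.Nat using (ℕ; _≤_)
open import Data.Nat.Primality using (Prime)
open import Data.Nat.Divisibility using (_∣_; quotient)
open import Data.Fin using (Fin)
open import Data.Product using (Σ; _×_)
open import Relation.Binary.PropositionalEquality using (_≡_)
open import Relation.Nullary using (¬_)

open import Level using (0ℓ)
import Data.Fin as Fin
open import Data.Nat as ℕ using (zero; suc; z≤n; s≤s; _<_; NonZero)
import Data.Nat.Properties as ℕₚ
import Data.Nat.Divisibility as ℕ∣
open import Data.Nat.DivMod using (_%_; [m+kn]%n≡m%n)
open import Data.Nat.Primality using (euclidsLemma; ¬prime[1])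
open import Data.Integer as ℤ using (ℤ; +_; -_; _+_; _-_; _*_)
import Data.Integer.Properties as ℤₚ
import Data.Integer.Divisibility.Signed as ℤ∣
open import Data.Integer.Tactic.RingSolver using (solve-∀)
open import Data.List using ([]; _∷_; replicate; _++_; map; length; applyUpTo)
open import Data.Product using (∃; _,_; proj₁; proj₂)
open import Data.Sum using (inj₁; inj₂)
open import Function using (_∘_)
open import Relation.Binary using (Setoid; tri<; tri≈; tri>)
open import Relation.Binary.PropositionalEquality
  using (_≢_; refl; sym; trans; cong; cong₂; subst; module ≡-Reasoning)
open import Relation.Nullary using (Dec; yes; no; ¬?; _×-dec_; contradiction)
open import Relation.Nullary.Decidable using (map′; decidable-stable)

antidiagonalSum : (ℕ → ℕ → ℤ) → ℕ → ℤ
antidiagonalSum t zero    = t 0 0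
antidiagonalSum t (suc m) = t 0 (suc m) + antidiagonalSum (t ∘ suc) m

antidiagonalSum-last : ∀ t m →
  antidiagonalSum t (suc m) ≡ antidiagonalSum (λ i j → t i (suc j)) m + t (suc m) 0
antidiagonalSum-last t zero    = refl
antidiagonalSum-last t (suc m) = begin
  t 0 (2 ℕ.+ m) + antidiagonalSum (t ∘ suc) (suc m)
    ≡⟨ cong (λ s → t 0 (2 ℕ.+ m) + s) (antidiagonalSum-last (t ∘ suc) m) ⟩
  t 0 (2 ℕ.+ m) + (antidiagonalSum (λ i j → t (suc i) (suc j)) m + t (2 ℕ.+ m) 0)
    ≡⟨ ℤₚ.+-assoc (t 0 (2 ℕ.+ m)) _ _ ⟨
  t 0 (2 ℕ.+ m) + antidiagonalSum (λ i j → t (suc i) (suc j)) m + t (2 ℕ.+ m) 0 ∎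
  where open ≡-Reasoning

antidiagonalSum-swap : ∀ {t u} → (∀ i j → t i j ≡ u j i) →
  ∀ m → antidiagonalSum t m ≡ antidiagonalSum u m
antidiagonalSum-swap t≡u zero    = t≡u 0 0
antidiagonalSum-swap {t} {u} t≡u (suc m) = begin
  t 0 (suc m) + antidiagonalSum (t ∘ suc) m
    ≡⟨ cong₂ _+_ (t≡u 0 (suc m)) (antidiagonalSum-swap (λ i j → t≡u (suc i) j) m) ⟩
  u (suc m) 0 + antidiagonalSum (λ i j → u i (suc j)) m
    ≡⟨ ℤₚ.+-comm (u (suc m) 0) _ ⟩
  antidiagonalSum (λ i j → u i (suc j)) m + u (suc m) 0
    ≡⟨ antidiagonalSum-last u m ⟨
  antidiagonalSum u (suc m) ∎
  where open ≡-Reasoning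

antidiagonalSum-zero : ∀ {t} → (∀ i j → t i j ≡ + 0) → ∀ m → antidiagonalSum t m ≡ + 0
antidiagonalSum-zero t≡0 zero    = t≡0 0 0
antidiagonalSum-zero t≡0 (suc m) =
  cong₂ _+_ (t≡0 0 (suc m)) (antidiagonalSum-zero (t≡0 ∘ suc) m)

coeff-≥length : ∀ f {i} → length f ≤ i → coeff f i ≡ + 0
coeff-≥length []      _         = refl
coeff-≥length (a ∷ f) (s≤s f≤i) = coeff-≥length f f≤i

coeff-+ₚ : ∀ f g i → coeff (f +ₚ g) i ≡ coeff f i + coeff g i
coeff-+ₚ []      g       i       = sym (ℤₚ.+-identityˡ _)
coeff-+ₚ (a ∷ f) []      zero    = sym (ℤₚ.+-identityʳ a)
coeff-+ₚ (a ∷ f) []      (suc i) = sym (ℤₚ.+-identityʳ _)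
coeff-+ₚ (a ∷ f) (b ∷ g) zero    = refl
coeff-+ₚ (a ∷ f) (b ∷ g) (suc i) = coeff-+ₚ f g i

coeff-map-* : ∀ a g i → coeff (map (a *_) g) i ≡ a * coeff g i
coeff-map-* a []      i       = sym (ℤₚ.*-zeroʳ a)
coeff-map-* a (b ∷ g) zero    = refl
coeff-map-* a (b ∷ g) (suc i) = coeff-map-* a g i

coeff-∷-*ₚ : ∀ a f g i → coeff ((a ∷ f) *ₚ g) i ≡ a * coeff g i + coeff (+ 0 ∷ (f *ₚ g)) i
coeff-∷-*ₚ a f g i = trans (coeff-+ₚ (map (a *_) g) _ i) (cong₂ _+_ (coeff-map-* a g i) refl)

coeff-*ₚ : ∀ f g m → coeff (f *ₚ g) m ≡ antidiagonalSum (λ i j → coeff f i * coeff g j) m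
coeff-*ₚ []      g m       = sym (antidiagonalSum-zero (λ _ _ → refl) m)
coeff-*ₚ (a ∷ f) g zero    = trans (coeff-∷-*ₚ a f g 0) (ℤₚ.+-identityʳ _)
coeff-*ₚ (a ∷ f) g (suc m) =
  trans (coeff-∷-*ₚ a f g (suc m)) (cong (λ s → a * coeff g (suc m) + s) (coeff-*ₚ f g m))

coeff-*ₚ-comm : ∀ f g m → coeff (f *ₚ g) m ≡ coeff (g *ₚ f) m
coeff-*ₚ-comm f g m = begin
  coeff (f *ₚ g) m                                   ≡⟨ coeff-*ₚ f g m ⟩
  antidiagonalSum (λ i j → coeff f i * coeff g j) m
    ≡⟨ antidiagonalSum-swap (λ i j → ℤₚ.*-comm (coeff f i) (coeff g j)) m ⟩
  antidiagonalSum (λ i j → coeff g i * coeff f j) m  ≡⟨ coeff-*ₚ g f m ⟨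
  coeff (g *ₚ f) m                                   ∎
  where open ≡-Reasoning

coeff-zeros-++-< : ∀ {j i} L → i < j → coeff (replicate j (+ 0) ++ L) i ≡ + 0
coeff-zeros-++-< {suc j} {zero}  L _         = refl
coeff-zeros-++-< {suc j} {suc i} L (s≤s i<j) = coeff-zeros-++-< L i<j

coeff-zeros-++-+ : ∀ j L i → coeff (replicate j (+ 0) ++ L) (j ℕ.+ i) ≡ coeff L i
coeff-zeros-++-+ zero    L i = refl
coeff-zeros-++-+ (suc j) L i = coeff-zeros-++-+ j L i

coeff-zeros-++-*ₚ : ∀ j L g m →
  coeff ((replicate j (+ 0) ++ L) *ₚ g) (j ℕ.+ m) ≡ coeff (L *ₚ g) m
coeff-zeros-++-*ₚ zero    L g m = refl
coeff-zeros-++-*ₚ (suc j) L g m =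
  trans (coeff-∷-*ₚ (+ 0) (replicate j (+ 0) ++ L) g (suc j ℕ.+ m))
        (trans (ℤₚ.+-identityˡ _) (coeff-zeros-++-*ₚ j L g m))

coeff-applyUpTo : ∀ u N → (∀ {t} → N ≤ t → u t ≡ + 0) → ∀ t → coeff (applyUpTo u N) t ≡ u t
coeff-applyUpTo u zero    u≡0 t       = sym (u≡0 z≤n)
coeff-applyUpTo u (suc N) u≡0 zero    = refl
coeff-applyUpTo u (suc N) u≡0 (suc t) = coeff-applyUpTo (u ∘ suc) N (u≡0 ∘ s≤s) t

coeff-subst-xk-t*k : ∀ k′ F t → coeff (subst-xk (suc k′) F) (t ℕ.* suc k′) ≡ coeff F t
coeff-subst-xk-t*k k′ []      t       = refl
coeff-subst-xk-t*k k′ (a ∷ F) zero    = refl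
coeff-subst-xk-t*k k′ (a ∷ F) (suc t) =
  trans (coeff-zeros-++-+ k′ (subst-xk (suc k′) F) (t ℕ.* suc k′)) (coeff-subst-xk-t*k k′ F t)

coeff-subst-xk-∤ : ∀ k′ F i → ¬ suc k′ ∣ i → coeff (subst-xk (suc k′) F) i ≡ + 0
coeff-subst-xk-∤ k′ []      i       _   = refl
coeff-subst-xk-∤ k′ (a ∷ F) zero    k∤0 = contradiction (suc k′ ℕ∣.∣0) k∤0
coeff-subst-xk-∤ k′ (a ∷ F) (suc i) k∤i with i ℕ.<? k′
... | yes i<k′ = coeff-zeros-++-< (subst-xk (suc k′) F) i<k′
... | no  i≮k′ with ℕₚ.m≤n⇒∃[o]m+o≡n (ℕₚ.≮⇒≥ i≮k′)
...   | m , refl = trans (coeff-zeros-++-+ k′ (subst-xk (suc k′) F) m)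
                         (coeff-subst-xk-∤ k′ F m (k∤i ∘ ℕ∣.∣m∣n⇒∣m+n ℕ∣.∣-refl))

coeff-*ₚ-subst-xk-t*k : ∀ k′ F G t →
  coeff (subst-xk (suc k′) F *ₚ subst-xk (suc k′) G) (t ℕ.* suc k′) ≡ coeff (F *ₚ G) t
coeff-*ₚ-subst-xk-t*k k′ []      G t = refl
coeff-*ₚ-subst-xk-t*k k′ (a ∷ F) G t = begin
  coeff ((a ∷ F′) *ₚ G′) (t ℕ.* suc k′)
    ≡⟨ coeff-∷-*ₚ a F′ G′ (t ℕ.* suc k′) ⟩
  a * coeff G′ (t ℕ.* suc k′) + coeff (+ 0 ∷ (F′ *ₚ G′)) (t ℕ.* suc k′)
    ≡⟨ cong₂ _+_ (cong (a *_) (coeff-subst-xk-t*k k′ G t)) (higher t) ⟩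
  a * coeff G t + coeff (+ 0 ∷ (F *ₚ G)) t
    ≡⟨ coeff-∷-*ₚ a F G t ⟨
  coeff ((a ∷ F) *ₚ G) t ∎
  where
  open ≡-Reasoning
  F′ = replicate k′ (+ 0) ++ subst-xk (suc k′) F
  G′ = subst-xk (suc k′) G
  higher : ∀ t → coeff (+ 0 ∷ (F′ *ₚ G′)) (t ℕ.* suc k′) ≡ coeff (+ 0 ∷ (F *ₚ G)) t
  higher zero    = refl
  higher (suc t) = trans (coeff-zeros-++-*ₚ k′ (subst-xk (suc k′) F) G′ (t ℕ.* suc k′))
                         (coeff-*ₚ-subst-xk-t*k k′ F G t)

coeff-xPow-≡ : ∀ n → coeff (xPow n) n ≡ + 1
coeff-xPow-≡ zero    = refl
coeff-xPow-≡ (suc n) = coeff-xPow-≡ n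

coeff-xPow-≢ : ∀ n m → m ≢ n → coeff (xPow n) m ≡ + 0
coeff-xPow-≢ zero    zero    m≢n = contradiction refl m≢n
coeff-xPow-≢ zero    (suc m) _   = refl
coeff-xPow-≢ (suc n) zero    _   = refl
coeff-xPow-≢ (suc n) (suc m) m≢n = coeff-xPow-≢ n m (m≢n ∘ cong suc)

coeff-Δ-0 : ∀ {n} ε → 1 ≤ n → coeff (Δ n ε) 0 ≡ - sgn ε
coeff-Δ-0 ε (s≤s _) = ℤₚ.+-identityˡ (- sgn ε)

coeff-Δ-≢ : ∀ n ε {m} → m ≢ 0 → m ≢ n → coeff (Δ n ε) m ≡ + 0
coeff-Δ-≢ n ε {zero}  m≢0 _   = contradiction refl m≢0
coeff-Δ-≢ n ε {suc m} _   m≢n =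
  trans (coeff-+ₚ (xPow n) (- sgn ε ∷ []) (suc m)) (cong₂ _+_ (coeff-xPow-≢ n (suc m) m≢n) refl)

coeff-Δ-t*k : ∀ k′ q ε t → coeff (Δ (q ℕ.* suc k′) ε) (t ℕ.* suc k′) ≡ coeff (Δ q ε) t
coeff-Δ-t*k k′ q ε t = begin
  coeff (Δ (q ℕ.* suc k′) ε) (t ℕ.* suc k′)
    ≡⟨ coeff-+ₚ (xPow (q ℕ.* suc k′)) (- sgn ε ∷ []) (t ℕ.* suc k′) ⟩
  coeff (xPow (q ℕ.* suc k′)) (t ℕ.* suc k′) + coeff (- sgn ε ∷ []) (t ℕ.* suc k′)
    ≡⟨ cong₂ _+_ xPow-* (constant-* t) ⟩
  coeff (xPow q) t + coeff (- sgn ε ∷ []) t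
    ≡⟨ coeff-+ₚ (xPow q) (- sgn ε ∷ []) t ⟨
  coeff (Δ q ε) t ∎
  where
  open ≡-Reasoning
  xPow-* : coeff (xPow (q ℕ.* suc k′)) (t ℕ.* suc k′) ≡ coeff (xPow q) t
  xPow-* with t ℕ.≟ q
  ... | yes refl = trans (coeff-xPow-≡ (t ℕ.* suc k′)) (sym (coeff-xPow-≡ t))
  ... | no  t≢q  = trans (coeff-xPow-≢ _ _ (t≢q ∘ ℕₚ.*-cancelʳ-≡ t q (suc k′)))
                         (sym (coeff-xPow-≢ q t t≢q))
  constant-* : ∀ t → coeff (- sgn ε ∷ []) (t ℕ.* suc k′) ≡ coeff (- sgn ε ∷ []) t
  constant-* zero    = refl
  constant-* (suc t) = refl

greatest : ∀ {P : ℕ → Set} → (∀ i → Dec (P i)) → ∀ N → (∀ {i} → N ≤ i → ¬ P i) →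
           ∀ {i} → P i → ∃ λ a → i ≤ a × P a × (∀ {j} → a < j → ¬ P j)
greatest P? zero    bound Pi = contradiction Pi (bound z≤n)
greatest P? (suc N) bound {i} Pi with P? N
... | yes PN = N , ℕₚ.≮⇒≥ (λ N<i → bound N<i Pi) , PN , bound
... | no ¬PN = greatest P? N bound′ Pi
  where
  bound′ : ∀ {j} → N ≤ j → ¬ _
  bound′ N≤j with ℕₚ.m≤n⇒m<n∨m≡n N≤j
  ... | inj₁ N<j  = bound N<j
  ... | inj₂ refl = ¬PN

∣⇒[m+n]%k≡n%k : ∀ {k m} n .{{_ : NonZero k}} → k ∣ m → (m ℕ.+ n) % k ≡ n % k
∣⇒[m+n]%k≡n%k {k} n (ℕ∣.divides t refl) =
  trans (cong (_% k) (ℕₚ.+-comm (t ℕ.* k) n)) ([m+kn]%n≡m%n n t k)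

%-cancel-multiples : ∀ {k i j a b} .{{_ : NonZero k}} → k ∣ i → k ∣ a →
                     i ℕ.+ j ≡ a ℕ.+ b → j % k ≡ b % k
%-cancel-multiples {k} {i} {j} {a} {b} k∣i k∣a e = begin
  j % k          ≡⟨ ∣⇒[m+n]%k≡n%k j k∣i ⟨
  (i ℕ.+ j) % k  ≡⟨ cong (_% k) e ⟩
  (a ℕ.+ b) % k  ≡⟨ ∣⇒[m+n]%k≡n%k b k∣a ⟩
  b % k          ∎
  where open ≡-Reasoning

∣-resp-%≡ : ∀ {k j j′} .{{_ : NonZero k}} → j % k ≡ j′ % k → k ∣ j → k ∣ j′
∣-resp-%≡ {k} {j} {j′} e k∣j = ℕ∣.m%n≡0⇒n∣m j′ k (trans (sym e) (ℕ∣.n∣m⇒m%n≡0 j k k∣j))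

module Modulo (p : ℕ) where

  p∣_ : ℤ → Set
  p∣ x = + p ℤ∣.∣ x

  infix 4 _≈_ _≉_

  -- A record rather than p∣ (a - b) itself, so that a and b can be inferred.
  record _≈_ (a b : ℤ) : Set where
    constructor mk≈
    field p∣a-b : p∣ (a - b)

  _≉_ : ℤ → ℤ → Set
  a ≉ b = ¬ a ≈ b

  ≡[mod]⇒≈ : ∀ {a b} → a ≡ b [mod p ] → a ≈ b
  ≡[mod]⇒≈ = mk≈ ∘ ℤ∣.∣ᵤ⇒∣

  ≈⇒≡[mod] : ∀ {a b} → a ≈ b → a ≡ b [mod p ]
  ≈⇒≡[mod] (mk≈ p∣a-b) = ℤ∣.∣⇒∣ᵤ p∣a-b

  ≈-reflexive : ∀ {a b} → a ≡ b → a ≈ b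
  ≈-reflexive {a} refl = mk≈ (subst p∣_ (sym (ℤₚ.+-inverseʳ a)) (ℤ∣.divides (+ 0) refl))

  ≈-refl : ∀ {a} → a ≈ a
  ≈-refl = ≈-reflexive refl

  ≈-sym : ∀ {a b} → a ≈ b → b ≈ a
  ≈-sym {a} {b} (mk≈ d) = mk≈ (subst p∣_ (identity a b) (ℤ∣.∣m⇒∣-m d))
    where
    identity : ∀ a b → - (a - b) ≡ b - a
    identity = solve-∀

  ≈-trans : ∀ {a b c} → a ≈ b → b ≈ c → a ≈ c
  ≈-trans {a} {b} {c} (mk≈ d) (mk≈ e) = mk≈ (subst p∣_ (identity a b c) (ℤ∣.∣m∣n⇒∣m+n d e))
    where
    identity : ∀ a b c → (a - b) + (b - c) ≡ a - c
    identity = solve-∀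

  +-cong : ∀ {a b c d} → a ≈ b → c ≈ d → a + c ≈ b + d
  +-cong {a} {b} {c} {d} (mk≈ e) (mk≈ f) =
    mk≈ (subst p∣_ (identity a b c d) (ℤ∣.∣m∣n⇒∣m+n e f))
    where
    identity : ∀ a b c d → (a - b) + (c - d) ≡ (a + c) - (b + d)
    identity = solve-∀

  *-cong : ∀ {a b c d} → a ≈ b → c ≈ d → a * c ≈ b * d
  *-cong {a} {b} {c} {d} (mk≈ e) (mk≈ f) =
    mk≈ (subst p∣_ (identity a b c d) (ℤ∣.∣m∣n⇒∣m+n (ℤ∣.∣m⇒∣m*n c e) (ℤ∣.∣n⇒∣m*n b f)))
    where
    identity : ∀ a b c d → (a - b) * c + b * (c - d) ≡ a * c - b * d
    identity = solve-∀

  ≈-setoid : Setoid 0ℓ 0ℓ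
  ≈-setoid = record
    { Carrier       = ℤ
    ; _≈_           = _≈_
    ; isEquivalence = record { refl = ≈-refl ; sym = ≈-sym ; trans = ≈-trans }
    }

  open import Relation.Binary.Reasoning.Setoid ≈-setoid

  *-≈0ˡ : ∀ {a} b → a ≈ + 0 → a * b ≈ + 0
  *-≈0ˡ b a≈0 = ≈-trans (*-cong a≈0 (≈-refl {b})) ≈-refl

  *-≈0ʳ : ∀ a {b} → b ≈ + 0 → a * b ≈ + 0
  *-≈0ʳ a b≈0 = ≈-trans (*-cong (≈-refl {a}) b≈0) (≈-reflexive (ℤₚ.*-zeroʳ a))

  ≈0⇒p∣ : ∀ {a} → a ≈ + 0 → p∣ a
  ≈0⇒p∣ {a} (mk≈ d) = subst p∣_ (ℤₚ.+-identityʳ a) d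

  p∣⇒≈0 : ∀ {a} → p∣ a → a ≈ + 0
  p∣⇒≈0 {a} d = mk≈ (subst p∣_ (sym (ℤₚ.+-identityʳ a)) d)

  ≈0? : ∀ a → Dec (a ≈ + 0)
  ≈0? a = map′ p∣⇒≈0 ≈0⇒p∣ (+ p ℤ∣.∣? a)

  antidiagonalSum-cong : ∀ {t u} m → (∀ i j → i ℕ.+ j ≡ m → t i j ≈ u i j) →
                         antidiagonalSum t m ≈ antidiagonalSum u m
  antidiagonalSum-cong zero    t≈u = t≈u 0 0 refl
  antidiagonalSum-cong (suc m) t≈u =
    +-cong (t≈u 0 (suc m) refl) (antidiagonalSum-cong m (λ i j → t≈u (suc i) j ∘ cong suc))

  antidiagonalSum-≈0 : ∀ {t} m → (∀ i j → i ℕ.+ j ≡ m → t i j ≈ + 0) →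
                       antidiagonalSum t m ≈ + 0
  antidiagonalSum-≈0 m t≈0 =
    ≈-trans (antidiagonalSum-cong m t≈0) (≈-reflexive (antidiagonalSum-zero (λ _ _ → refl) m))

  antidiagonalSum-single : ∀ {t} a b → (∀ i j → i ℕ.+ j ≡ a ℕ.+ b → i ≢ a → t i j ≈ + 0) →
                           antidiagonalSum t (a ℕ.+ b) ≈ t a b
  antidiagonalSum-single zero zero _ = ≈-refl
  antidiagonalSum-single {t} zero (suc b) others = begin
    t 0 (suc b) + antidiagonalSum (t ∘ suc) b
      ≈⟨ +-cong (≈-refl {t 0 (suc b)})
                (antidiagonalSum-≈0 b (λ i j e → others (suc i) j (cong suc e) (λ ()))) ⟩
    t 0 (suc b) + + 0   ≡⟨ ℤₚ.+-identityʳ _ ⟩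
    t 0 (suc b)         ∎
  antidiagonalSum-single {t} (suc a) b others = begin
    t 0 (suc a ℕ.+ b) + antidiagonalSum (t ∘ suc) (a ℕ.+ b)
      ≈⟨ +-cong (others 0 _ refl (λ ()))
                (antidiagonalSum-single a b
                  (λ i j e i≢a → others (suc i) j (cong suc e) (i≢a ∘ ℕₚ.suc-injective))) ⟩
    + 0 + t (suc a) b   ≡⟨ ℤₚ.+-identityˡ _ ⟩
    t (suc a) b         ∎

  *ₚ-cong : ∀ f f′ g g′ → (∀ i → coeff f i ≈ coeff f′ i) → (∀ j → coeff g j ≈ coeff g′ j) →
            ∀ m → coeff (f *ₚ g) m ≈ coeff (f′ *ₚ g′) m
  *ₚ-cong f f′ g g′ f≈f′ g≈g′ m = begin
    coeff (f *ₚ g) m                                      ≡⟨ coeff-*ₚ f g m ⟩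
    antidiagonalSum (λ i j → coeff f i * coeff g j) m
      ≈⟨ antidiagonalSum-cong m (λ i j _ → *-cong (f≈f′ i) (g≈g′ j)) ⟩
    antidiagonalSum (λ i j → coeff f′ i * coeff g′ j) m   ≡⟨ coeff-*ₚ f′ g′ m ⟨
    coeff (f′ *ₚ g′) m                                    ∎

  subst-xk-factorisation : ∀ g h G H d n ε → (g *ₚ h) ≈[ p ] Δ (n ℕ.* suc d) ε →
    g ≈[ p ] subst-xk (suc d) G → h ≈[ p ] subst-xk (suc d) H → (G *ₚ H) ≈[ p ] Δ n ε
  subst-xk-factorisation g h G H d n ε gh≈Δ g≈G h≈H t = ≈⇒≡[mod] (begin
    coeff (G *ₚ H) t                          ≡⟨ coeff-*ₚ-subst-xk-t*k d G H t ⟨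
    coeff (G′ *ₚ H′) (t ℕ.* suc d)            ≈⟨ *ₚ-cong G′ g H′ h G′≈g H′≈h (t ℕ.* suc d) ⟩
    coeff (g *ₚ h) (t ℕ.* suc d)              ≈⟨ ≡[mod]⇒≈ (gh≈Δ (t ℕ.* suc d)) ⟩
    coeff (Δ (n ℕ.* suc d) ε) (t ℕ.* suc d)   ≡⟨ coeff-Δ-t*k d n ε t ⟩
    coeff (Δ n ε) t                           ∎)
    where
    G′ = subst-xk (suc d) G
    H′ = subst-xk (suc d) H
    G′≈g : ∀ i → coeff G′ i ≈ coeff g i
    G′≈g i = ≈-sym (≡[mod]⇒≈ (g≈G i))
    H′≈h : ∀ i → coeff H′ i ≈ coeff h i
    H′≈h i = ≈-sym (≡[mod]⇒≈ (h≈H i))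

  polyIn⇒∤-coeff≈0 : ∀ f {k′} → PolyIn p f (suc k′) → ∀ i → ¬ suc k′ ∣ i → coeff f i ≈ + 0
  polyIn⇒∤-coeff≈0 f {k′} (F , f≈F) i k∤i = begin
    coeff f i                        ≈⟨ ≡[mod]⇒≈ (f≈F i) ⟩
    coeff (subst-xk (suc k′) F) i    ≡⟨ coeff-subst-xk-∤ k′ F i k∤i ⟩
    + 0                              ∎

  ∤-coeff≈0⇒polyIn : ∀ f {k′} → (∀ i → ¬ suc k′ ∣ i → coeff f i ≈ + 0) → PolyIn p f (suc k′)
  ∤-coeff≈0⇒polyIn f {k′} f∤≈0 = F , ≈⇒≡[mod] ∘ f≈F
    where
    F = applyUpTo (λ t → coeff f (t ℕ.* suc k′)) (length f)
    F-coeff : ∀ t → coeff F t ≡ coeff f (t ℕ.* suc k′)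
    F-coeff = coeff-applyUpTo _ (length f)
      (λ {t} f≤t → coeff-≥length f (ℕₚ.≤-trans f≤t (ℕₚ.m≤m*n t (suc k′))))
    f≈F : ∀ i → coeff f i ≈ coeff (subst-xk (suc k′) F) i
    f≈F i with suc k′ ℕ∣.∣? i
    ... | yes (ℕ∣.divides t refl) =
      ≈-reflexive (sym (trans (coeff-subst-xk-t*k k′ F t) (F-coeff t)))
    ... | no k∤i = ≈-trans (f∤≈0 i k∤i) (≈-reflexive (sym (coeff-subst-xk-∤ k′ F i k∤i)))

  module _ (p-prime : Prime p) where

    *-≉0 : ∀ {a b} → a ≉ + 0 → b ≉ + 0 → a * b ≉ + 0
    *-≉0 {a} {b} a≉0 b≉0 ab≈0
      with euclidsLemma ℤ.∣ a ∣ ℤ.∣ b ∣ p-prime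
             (subst (p ℕ∣.∣_) (ℤₚ.abs-* a b) (ℤ∣.∣⇒∣ᵤ (≈0⇒p∣ ab≈0)))
    ... | inj₁ p∣a = a≉0 (p∣⇒≈0 (ℤ∣.∣ᵤ⇒∣ p∣a))
    ... | inj₂ p∣b = b≉0 (p∣⇒≈0 (ℤ∣.∣ᵤ⇒∣ p∣b))

    p∤1 : ¬ p ℕ∣.∣ 1
    p∤1 p∣1 with ℕ∣.∣1⇒≡1 p∣1
    ... | refl = ¬prime[1] p-prime

    -sgn≉0 : ∀ ε → - sgn ε ≉ + 0
    -sgn≉0 Fin.zero    = p∤1 ∘ ℤ∣.∣⇒∣ᵤ ∘ ≈0⇒p∣
    -sgn≉0 (Fin.suc _) = p∤1 ∘ ℤ∣.∣⇒∣ᵤ ∘ ≈0⇒p∣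

module Cofactor {p : ℕ} (p-prime : Prime p) {n : ℕ} (n≥1 : 1 ≤ n) (ε : Fin 2)
                (f q : Poly) (fq≈Δ : (f *ₚ q) ≈[ p ] Δ n ε) where

  open Modulo p
  open import Relation.Binary.Reasoning.Setoid ≈-setoid

  coeff₀≉0 : coeff q 0 ≉ + 0
  coeff₀≉0 q₀≈0 = -sgn≉0 p-prime ε (begin
    - sgn ε                ≡⟨ coeff-Δ-0 ε n≥1 ⟨
    coeff (Δ n ε) 0        ≈⟨ ≈-sym (≡[mod]⇒≈ (fq≈Δ 0)) ⟩
    coeff (f *ₚ q) 0       ≡⟨ coeff-*ₚ f q 0 ⟩
    coeff f 0 * coeff q 0  ≈⟨ *-≈0ʳ (coeff f 0) q₀≈0 ⟩
    + 0                    ∎)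

  isolated-term⇒degree≡n : ∀ {a b} → 1 ≤ a → coeff f a ≉ + 0 → coeff q b ≉ + 0 →
    (∀ i j → i ℕ.+ j ≡ a ℕ.+ b → i ≢ a → coeff f i * coeff q j ≈ + 0) → a ℕ.+ b ≡ n
  isolated-term⇒degree≡n {a} {b} (s≤s _) fa≉0 qb≉0 others with a ℕ.+ b ℕ.≟ n
  ... | yes a+b≡n = a+b≡n
  ... | no  a+b≢n = contradiction (begin
    coeff f a * coeff q b                                  ≈⟨ antidiagonalSum-single a b others ⟨
    antidiagonalSum (λ i j → coeff f i * coeff q j) (a ℕ.+ b) ≡⟨ coeff-*ₚ f q (a ℕ.+ b) ⟨
    coeff (f *ₚ q) (a ℕ.+ b)                               ≈⟨ ≡[mod]⇒≈ (fq≈Δ (a ℕ.+ b)) ⟩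
    coeff (Δ n ε) (a ℕ.+ b)                                ≡⟨ coeff-Δ-≢ n ε (λ ()) a+b≢n ⟩
    + 0                                                    ∎) (*-≉0 p-prime fa≉0 qb≉0)

  module TopDegree {k a : ℕ} .{{_ : NonZero k}} (a≥1 : 1 ≤ a) (k∣a : k ∣ a) (fa≉0 : coeff f a ≉ + 0)
           (f-above : ∀ {i} → a < i → coeff f i ≈ + 0) (f∤ : ∀ i → ¬ k ∣ i → coeff f i ≈ + 0)
           where

    -- j is the top degree of q within the residue class of j₀.
    residue-partner : ∀ {j₀} → coeff q j₀ ≉ + 0 → ∃ λ j → j % k ≡ j₀ % k × a ℕ.+ j ≡ n
    residue-partner {j₀} qj₀≉0
      with greatest (λ j → (j % k ℕ.≟ j₀ % k) ×-dec ¬? (≈0? (coeff q j))) (length q)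
                    (λ q≤j (_ , qj≉0) → qj≉0 (≈-reflexive (coeff-≥length q q≤j))) (refl , qj₀≉0)
    ... | j , _ , (j≡j₀ , qj≉0) , q-above =
      j , j≡j₀ , isolated-term⇒degree≡n a≥1 fa≉0 qj≉0 others
      where
      others : ∀ i j′ → i ℕ.+ j′ ≡ a ℕ.+ j → i ≢ a → coeff f i * coeff q j′ ≈ + 0
      others i j′ e i≢a with ℕₚ.<-cmp i a
      ... | tri> _ _ a<i = *-≈0ˡ (coeff q j′) (f-above a<i)
      ... | tri≈ _ i≡a _ = contradiction i≡a i≢a
      ... | tri< i<a _ _ with k ℕ∣.∣? i
      ...   | no  k∤i = *-≈0ˡ (coeff q j′) (f∤ i k∤i)
      ...   | yes k∣i = *-≈0ʳ (coeff f i)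
                          (decidable-stable (≈0? _) (λ qj′≉0 → q-above j<j′ (j′≡j₀ , qj′≉0)))
        where
        j<j′ : j < j′
        j<j′ = ℕₚ.≰⇒> (λ j′≤j → ℕₚ.<⇒≢ (ℕₚ.+-mono-<-≤ i<a j′≤j) e)
        j′≡j₀ : j′ % k ≡ j₀ % k
        j′≡j₀ = trans (%-cancel-multiples k∣i k∣a e) j≡j₀

    k∣n : k ∣ n
    k∣n with residue-partner coeff₀≉0
    ... | j , j≡0 , a+j≡n =
      subst (k ∣_) a+j≡n (ℕ∣.∣m∣n⇒∣m+n k∣a (∣-resp-%≡ (sym j≡0) (k ℕ∣.∣0)))

    support⊆kℕ : ∀ {j₀} → coeff q j₀ ≉ + 0 → k ∣ j₀
    support⊆kℕ {j₀} qj₀≉0 with residue-partner qj₀≉0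
    ... | j , j≡j₀ , a+j≡n =
      ∣-resp-%≡ j≡j₀ (ℕ∣.∣m+n∣m⇒∣n (subst (k ∣_) (sym a+j≡n) k∣n) k∣a)

  polyIn-cofactor : ∀ {k} → 1 ≤ k → Nonconstant p f → PolyIn p f k → k ∣ n × PolyIn p q k
  polyIn-cofactor {suc k′} _ (i₁ , i₁≥1 , fi₁≢0) f∈k
    with greatest (λ i → ¬? (≈0? (coeff f i))) (length f)
                  (λ f≤i fi≉0 → fi≉0 (≈-reflexive (coeff-≥length f f≤i))) (fi₁≢0 ∘ ≈⇒≡[mod])
  ... | a , i₁≤a , fa≉0 , f-above =
    k∣n , ∤-coeff≈0⇒polyIn q (λ j k∤j → decidable-stable (≈0? _) (k∤j ∘ support⊆kℕ))
    where
    f∤ : ∀ i → ¬ suc k′ ∣ i → coeff f i ≈ + 0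
    f∤ = polyIn⇒∤-coeff≈0 f f∈k
    a≥1 : 1 ≤ a
    a≥1 = ℕₚ.≤-trans i₁≥1 i₁≤a
    k∣a : suc k′ ∣ a
    k∣a = decidable-stable (suc k′ ℕ∣.∣? a) (λ k∤a → fa≉0 (f∤ a k∤a))
    f-above′ : ∀ {i} → a < i → coeff f i ≈ + 0
    f-above′ a<i = decidable-stable (≈0? _) (f-above a<i)
    open TopDegree a≥1 k∣a fa≉0 f-above′ f∤

lemma2p3 : (p : ℕ) → Prime p → ¬ (p ≡ 2) →
    (n : ℕ) → 1 ≤ n → (ε : Fin 2) →
    (g h : Poly) → Nonconstant p g → Nonconstant p h →
    (g *ₚ h) ≈[ p ] Δ n ε →
    ((k : ℕ) → 1 ≤ k → PolyIn p g k → (k ∣ n) × PolyIn p h k)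
    × ((d : ℕ) → IsExp p g d →
        Σ (d ∣ n) λ d∣n →
          IsExp p h d
          × ((G H : Poly) → g ≈[ p ] subst-xk d G → h ≈[ p ] subst-xk d H →
               (G *ₚ H) ≈[ p ] Δ (quotient d∣n) ε))
lemma2p3 p p-prime _ n n≥1 ε g h g-nonconst h-nonconst gh≈Δ = g∈k⇒h∈k , isExp-cofactor
  where
  hg≈Δ : (h *ₚ g) ≈[ p ] Δ n ε
  hg≈Δ i = subst (_≡ coeff (Δ n ε) i [mod p ]) (coeff-*ₚ-comm g h i) (gh≈Δ i)

  g∈k⇒h∈k : (k : ℕ) → 1 ≤ k → PolyIn p g k → (k ∣ n) × PolyIn p h k
  g∈k⇒h∈k k k≥1 = Cofactor.polyIn-cofactor p-prime n≥1 ε g h gh≈Δ k≥1 g-nonconst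

  h∈k⇒g∈k : (k : ℕ) → 1 ≤ k → PolyIn p h k → PolyIn p g k
  h∈k⇒g∈k k k≥1 = proj₂ ∘ Cofactor.polyIn-cofactor p-prime n≥1 ε h g hg≈Δ k≥1 h-nonconst

  isExp-cofactor : (d : ℕ) → IsExp p g d →
    Σ (d ∣ n) λ d∣n → IsExp p h d ×
      ((G H : Poly) → g ≈[ p ] subst-xk d G → h ≈[ p ] subst-xk d H →
         (G *ₚ H) ≈[ p ] Δ (quotient d∣n) ε)
  isExp-cofactor zero    (() , _)
  isExp-cofactor (suc d) (d≥1 , g∈d , d-max) =
    d∣n , (d≥1 , proj₂ (g∈k⇒h∈k (suc d) d≥1 g∈d) , λ k k≥1 → d-max k k≥1 ∘ h∈k⇒g∈k k k≥1) ,
    λ G H → Modulo.subst-xk-factorisation p g h G H d (quotient d∣n) ε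
              (subst (λ m → (g *ₚ h) ≈[ p ] Δ m ε) (ℕ∣._∣_.equality d∣n) gh≈Δ)
    where
    d∣n : suc d ∣ n
    d∣n = proj₁ (g∈k⇒h∈k (suc d) d≥1 g∈d)
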